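{- Let $\mathcal{C}'$ be the set, up to isomorphism, of pairs $(\mathcal{G},\pi)$ where $\mathcal{G}=((V,E),\lambda)$ is a 1D-mobility temporal clique on $n$ nodes with labels $1,\dots,T$, $T=n(n-1)/2$, and $\pi$ is an ordering of $V$ such that $\mathcal{R}(\mathcal{G})$ is a 1D-mobility schedule from $\pi$. For such a pair, with $\mathcal{R}(\mathcal{G})=(u_1,v_1,1),\dots,(u_T,v_T,T)$, define $\pi_0=\pi$ and for $t=1,\dots,T$, $\tau_t=(i,j)$ where $i,j$ are the positions of $u_t,v_t$ in $\pi_{t-1}$, and $\pi_t=\pi_{t-1}\tau_t$; set $f(\mathcal{G},\pi)=\tau_1,\dots,\tau_T$. Then $f$ is a bijection from $\mathcal{C}'$ to the set $R(w_n)$ of reduced decompositions of $w_n$.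
   Context: A temporal clique $\mathcal{G}=((V,E),\lambda)$ is a complete graph on $n$ nodes with each edge given a single label, labels pairwise distinct; its representation $\mathcal{R}(\mathcal{G})$ is the list of triples $(u,v,\lambda(uv))$ sorted by label. An ordering is a map from positions $\{1,\dots,n\}$ to $V$; composing with a transposition $(i,j)$ of positions exchanges the elements at positions $i,j$. Pairs $(\mathcal{G},\pi)$ and $(\mathcal{G}',\pi')$ are isomorphic if a label-preserving vertex bijection maps $\pi$ to $\pi'$. 1D-mobility model: agents lie on a line in an initial ordering $\pi$. A 1D-mobility schedule from $\pi$ is a sequence $x=(x_1,\dots,x_T)$ of pairs where, with $\pi_0=\pi$, each $x_t=\{u,v\}$ consists of two agents consecutive in $\pi_{t-1}$ and $\pi_t$ is obtained by exchanging them. $\mathcal{G}_{\pi,x}$ is the temporal graph with edge $uv$ at time $t$ whenever $x_t=uv$. A 1D-mobility temporal clique is a temporal clique isomorphic to some $\mathcal{G}_{\pi,x}$. "$\mathcal{R}(\mathcal{G})$ is a 1D-mobility schedule from $\pi$" means the edges of $\mathcal{R}(\mathcal{G})$, read in increasing label order as crossings, form a valid 1D-mobility schedule from $\pi$. $w_n\in\mathcal{S}_n$ is the permutation $n,n-1,\dots,1$; a reduced decomposition of $w_n$ is a sequence of $n(n-1)/2$ adjacent transpositions $(i,i+1)$ whose product is $w_n$. -}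

module Defs where

open import Data.Nat using (ℕ; zero; suc; _*_; _∸_; _/_)
open import Data.Fin using (Fin; toℕ; _<?_; opposite)
open import Data.Fin.Permutation using (Permutation′; _⟨$⟩ʳ_; _⟨$⟩ˡ_; _∘ₚ_; transpose)
open import Data.Product using (_×_; _,_; proj₁; proj₂; ∃; ∃-syntax)
open import Data.Sum using (_⊎_)
open import Data.Vec using (Vec; []; _∷_; lookup; map)
open import Relation.Binary.PropositionalEquality using (_≡_; _≢_)
open import Relation.Nullary using (does)
open import Data.Bool using (if_then_else_)
open import Function using (_∘_; id)


numLabels : ℕ → ℕ
numLabels n = (n * (n ∸ 1)) / 2

-- An (undirected) edge is given by an ordered pair of endpoints;
-- two pairs denote the same edge iff they agree up to orientation.
Pair : ℕ → Set
Pair n = Fin n × Fin n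

SameEdge : ∀ {n} → Pair n → Pair n → Set
SameEdge (u , v) (u' , v') = (u ≡ u' × v ≡ v') ⊎ (u ≡ v' × v ≡ u')

-- It is encoded by its representation R(G): the edge at index t
-- (0-based) of `edges` is the unique edge with label toℕ t + 1.
record TClique (n : ℕ) : Set where
  field
    edges    : Vec (Pair n) (numLabels n)
    loopless : ∀ t → proj₁ (lookup edges t) ≢ proj₂ (lookup edges t)
    complete : ∀ u v → u ≢ v → ∃[ t ] SameEdge (lookup edges t) (u , v)
    simple   : ∀ t s → SameEdge (lookup edges t) (lookup edges s) → t ≡ s
open TClique public

-- An ordering: a bijection from positions (Fin n, 0-based) to vertices.
Ordering : ℕ → Set
Ordering n = Permutation′ n

pos : ∀ {n} → Ordering n → Fin n → Fin n
pos π u = π ⟨$⟩ˡ u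

Adjacent : ∀ {n} → Fin n → Fin n → Set
Adjacent i j = (toℕ j ≡ suc (toℕ i)) ⊎ (toℕ i ≡ suc (toℕ j))

-- π ∘ (i j) : position k ↦ π ((i j) k)   (note: ρ ∘ₚ π applies ρ first)
swapPos : ∀ {n} → Ordering n → Fin n → Fin n → Ordering n
swapPos π i j = transpose i j ∘ₚ π

cross : ∀ {n} → Ordering n → Pair n → Ordering n
cross π (u , v) = swapPos π (pos π u) (pos π v)

data Schedule {n : ℕ} : Ordering n → ∀ {m} → Vec (Pair n) m → Set where
  []  : ∀ {π} → Schedule π []
  _∷_ : ∀ {π m} {x : Pair n} {xs : Vec (Pair n) m} →
        Adjacent (pos π (proj₁ x)) (pos π (proj₂ x)) →
        Schedule (cross π x) xs →
        Schedule π (x ∷ xs)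

mapPair : ∀ {n} → (Fin n → Fin n) → Pair n → Pair n
mapPair σ (u , v) = σ u , σ v

-- G is a 1D-mobility temporal clique: G is isomorphic (via a
-- label-preserving vertex bijection σ) to G_{π₀,x} for some initial
-- ordering π₀ and schedule x from π₀; i.e. x is σ applied to R(G).
Is1DMobility : ∀ {n} → TClique n → Set
Is1DMobility {n} G =
  ∃[ π₀ ] ∃[ σ ] Schedule {n} π₀ (map (mapPair (σ ⟨$⟩ʳ_)) (edges G))

InC' : ∀ {n} → TClique n → Ordering n → Set
InC' G π = Is1DMobility G × Schedule π (edges G)

PairIso : ∀ {n} → TClique n → Ordering n → TClique n → Ordering n → Set
PairIso {n} G π G' π' = ∃[ σ ]
  ((∀ t → SameEdge (mapPair (σ ⟨$⟩ʳ_) (lookup (edges G) t)) (lookup (edges G') t))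
   × (∀ k → σ ⟨$⟩ʳ (π ⟨$⟩ʳ k) ≡ π' ⟨$⟩ʳ k))

-- A transposition (i j) of positions, written canonically with the
-- smaller position first (the transposition (i j) equals (j i)).
normT : ∀ {n} → Fin n → Fin n → Pair n
normT i j = if does (i <? j) then (i , j) else (j , i)

taus : ∀ {n m} → Ordering n → Vec (Pair n) m → Vec (Pair n) m
taus π [] = []
taus π ((u , v) ∷ xs) = normT (pos π u) (pos π v) ∷ taus (cross π (u , v)) xs

f : ∀ {n} → TClique n → Ordering n → Vec (Pair n) (numLabels n)
f G π = taus π (edges G)

prodT : ∀ {n m} → Vec (Pair n) m → Fin n → Fin n
prodT [] = id
prodT ((i , j) ∷ ts) = (transpose i j ⟨$⟩ʳ_) ∘ prodT ts

-- w_n = n, n-1, …, 1 (0-based: k ↦ n-1-k)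
-- A reduced decomposition of w_n: n(n-1)/2 adjacent transpositions
-- (i, i+1) whose product is w_n.
ReducedDecomp : (n : ℕ) → Vec (Pair n) (numLabels n) → Set
ReducedDecomp n w =
  (∀ t → toℕ (proj₂ (lookup w t)) ≡ suc (toℕ (proj₁ (lookup w t))))
  × (∀ k → prodT w k ≡ opposite k)

-- Reading each crossing as the transposition of the two positions it exchanges, the final ordering
-- of a schedule from π is π τ₁ ⋯ τ_T, and an isomorphism of pairs sends every crossing to a crossing
-- at the same positions; hence f is well defined and injective on isomorphism classes. In a temporal
-- clique every pair of agents crosses exactly once, so the final ordering reverses π and τ₁ ⋯ τ_T = w_n.
-- Conversely, replaying a reduced decomposition from the identity ordering ends in the reversed
-- ordering, so every pair crosses; since each crossing changes the number of inverted pairs by ±1 and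
-- T crossings take it from 0 to T, every crossing creates an inversion, so no pair crosses twice.

module Submission where

open import Defs
open import Data.Bool using (if_then_else_)
open import Data.Fin using (Fin; zero; suc; toℕ; _<_; _≤_; _<?_; _≟_; opposite; inject₁; fromℕ; punchIn)
open import Data.Fin.Induction using (<-weakInduction; >-weakInduction)
open import Data.Fin.Permutation
  using (_⟨$⟩ʳ_; _⟨$⟩ˡ_; _∘ₚ_; flip; inverseˡ; inverseʳ) renaming (id to idₚ)
open import Data.Fin.Permutation.Components using () renaming (transpose to swap)
open import Data.Fin.Properties
  using (suc-injective; 0≢1+n; <-irrefl; <-asym; <-trans; <-cmp; ≤∧≢⇒<; <⇒≢; ≤-antisym; toℕ-inject₁;
         ≤̄⇒inject₁<; ≤fromℕ; opposite-prop; opposite-involutive; punchInᵢ≢i; toℕ<n; toℕ-fromℕ)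
open import Data.Nat as ℕ using (ℕ; zero; suc; _+_; _*_; _∸_; _/_)
import Data.Nat.Properties as ℕ
open import Algebra.Properties.CommutativeMonoid.Sum ℕ.+-0-commutativeMonoid
  using (sum; sum-remove; sum-cong-≗; sum-replicate-zero; sum-init-last)
open import Data.Nat.DivMod using (m*n/n≡m)
open import Data.Nat.Tactic.RingSolver using (solve-∀)
open import Data.Product using (_×_; _,_; proj₁; proj₂; ∃-syntax)
open import Data.Sum using (_⊎_; inj₁; inj₂) renaming (swap to ⊎-swap)
open import Data.Unit using (⊤; tt)
open import Data.Vec using (Vec; []; _∷_; lookup)
open import Data.Vec.Properties using (map-id; ∷-injectiveˡ; ∷-injectiveʳ)
open import Function using (_∘_; _⇔_; mk⇔; Equivalence)
open import Function.Properties.Equivalence using () renaming (sym to ⇔-sym)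
open import Relation.Binary.Definitions using (tri<; tri≈; tri>)
open import Relation.Binary.PropositionalEquality
  using (_≡_; _≢_; refl; sym; trans; cong; cong₂; subst; subst₂; module ≡-Reasoning)
open import Relation.Nullary using (¬_; Dec; yes; no; does; contradiction)
open import Relation.Nullary.Decidable using (map′; _×-dec_; _⊎-dec_; dec-true; dec-false; does-⇔)

strictlyIncreasing⇒≗id : ∀ {n} (h : Fin n → Fin n) → (∀ {p q} → p < q → h p < h q) → ∀ k → h k ≡ k
strictlyIncreasing⇒≗id {suc n} h increasing k = ≤-antisym (below k) (above k)
  where
  inject₁<suc : (i : Fin n) → inject₁ i < suc i
  inject₁<suc i = ≤̄⇒inject₁< ℕ.≤-refl

  above : ∀ k → k ≤ h k
  above = <-weakInduction (λ k → k ≤ h k) ℕ.z≤n λ i i≤hi →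
    ℕ.≤-trans (ℕ.s≤s (subst (ℕ._≤ toℕ (h (inject₁ i))) (toℕ-inject₁ i) i≤hi))
              (increasing (inject₁<suc i))

  below : ∀ k → h k ≤ k
  below = >-weakInduction (λ k → h k ≤ k) (≤fromℕ (h (fromℕ n))) λ i hsi≤si →
    subst (toℕ (h (inject₁ i)) ℕ.≤_) (sym (toℕ-inject₁ i))
          (ℕ.≤-pred (ℕ.≤-trans (increasing (inject₁<suc i)) hsi≤si))

opposite-reverses-< : ∀ {n} {i j : Fin n} → i < j → opposite j < opposite i
opposite-reverses-< {n} {i} {j} i<j =
  subst₂ ℕ._<_ (sym (opposite-prop j)) (sym (opposite-prop i)) (ℕ.∸-monoʳ-< (ℕ.s≤s i<j) (toℕ<n j))

strictlyDecreasing⇒≗opposite : ∀ {n} (g : Fin n → Fin n) → (∀ {p q} → p < q → g q < g p) →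
                               ∀ k → g k ≡ opposite k
strictlyDecreasing⇒≗opposite g decreasing k =
  trans (sym (opposite-involutive (g k)))
        (cong opposite (strictlyIncreasing⇒≗id (opposite ∘ g) (opposite-reverses-< ∘ decreasing) k))

indicator : ∀ {P : Set} → Dec P → ℕ
indicator d = if does d then 1 else 0

indicator-yes : ∀ {P : Set} (d : Dec P) → P → indicator d ≡ 1
indicator-yes d p = cong (if_then 1 else 0) (dec-true d p)

indicator-no : ∀ {P : Set} (d : Dec P) → ¬ P → indicator d ≡ 0
indicator-no d ¬p = cong (if_then 1 else 0) (dec-false d ¬p)

indicator-cong : ∀ {P Q : Set} (d : Dec P) (e : Dec Q) → P ⇔ Q → indicator d ≡ indicator e
indicator-cong d e p⇔q = cong (if_then 1 else 0) (does-⇔ p⇔q d e)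

sum-zero : ∀ {n} {g : Fin n → ℕ} → (∀ k → g k ≡ 0) → sum g ≡ 0
sum-zero {n} g≗0 = trans (sum-cong-≗ g≗0) (sum-replicate-zero n)

sum-bump : ∀ {n} {g h : Fin n → ℕ} (i : Fin n) → (∀ k → k ≢ i → g k ≡ h k) → h i ≡ suc (g i) →
           sum h ≡ suc (sum g)
sum-bump {suc n} {g} {h} i agree bumped =
  trans (sum-remove {i = i} h)
    (trans (cong₂ _+_ bumped (sum-cong-≗ λ k → sym (agree (punchIn i k) (punchInᵢ≢i i k))))
           (cong suc (sym (sum-remove {i = i} g))))

sum-indicator-< : ∀ {n} (b : Fin n) → sum (λ (a : Fin n) → indicator (a <? b)) ≡ toℕ b
sum-indicator-< {suc n} zero    = sum-zero {suc n} λ a → indicator-no (a <? zero {n}) λ ()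
sum-indicator-< {suc n} (suc b) =
  cong₂ _+_ (indicator-yes (zero {n} <? suc b) ℕ.z<s)
            (trans (sum-cong-≗ {n} λ a → indicator-cong (suc a <? suc b) (a <? b) (mk⇔ ℕ.s≤s⁻¹ ℕ.s≤s))
                   (sum-indicator-< b))

sum-toℕ : ∀ n → sum (toℕ {n}) ≡ numLabels n
sum-toℕ n = sym (trans (cong (_/ 2) (sym (twice n))) (m*n/n≡m (sum (toℕ {n})) 2))
  where
  step : ∀ k S → S * 2 ≡ k * (k ∸ 1) → (S + k) * 2 ≡ suc k * k
  step zero    S e = trans (cong (_* 2) (ℕ.+-identityʳ S)) e
  step (suc k) S e = trans (ℕ.*-distribʳ-+ 2 S (suc k)) (trans (cong (_+ suc k * 2) e) (ring k))
    where
    ring : ∀ k → suc k * k + suc k * 2 ≡ suc (suc k) * suc k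
    ring = solve-∀

  twice : ∀ n → sum (toℕ {n}) * 2 ≡ n * (n ∸ 1)
  twice zero    = refl
  twice (suc n) = begin
    sum (toℕ {suc n}) * 2
      ≡⟨ cong (_* 2) (sum-init-last {n} toℕ) ⟩
    (sum (toℕ ∘ inject₁ {n}) + toℕ (fromℕ n)) * 2
      ≡⟨ cong₂ (λ S k → (S + k) * 2) (sum-cong-≗ {n} toℕ-inject₁) (toℕ-fromℕ n) ⟩
    (sum (toℕ {n}) + n) * 2
      ≡⟨ step n (sum (toℕ {n})) (twice n) ⟩
    suc n * n
      ∎
    where open ≡-Reasoning

module _ {n : ℕ} where

  swap-at-fst : (i j : Fin n) → swap i j i ≡ j
  swap-at-fst i j with i ≟ i
  ... | yes _  = refl
  ... | no i≢i = contradiction refl i≢i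

  swap-at-snd : (i j : Fin n) → swap i j j ≡ i
  swap-at-snd i j with j ≟ i
  ... | yes refl = refl
  ... | no _ with j ≟ j
  ...   | yes _  = refl
  ...   | no j≢j = contradiction refl j≢j

  swap-untouched : {i j k : Fin n} → k ≢ i → k ≢ j → swap i j k ≡ k
  swap-untouched {i} {j} {k} k≢i k≢j with k ≟ i
  ... | yes k≡i = contradiction k≡i k≢i
  ... | no _ with k ≟ j
  ...   | yes k≡j = contradiction k≡j k≢j
  ...   | no _    = refl

  data SwapCase (i j k : Fin n) : Fin n → Set where
    at-fst    : k ≡ i → SwapCase i j k j
    at-snd    : k ≡ j → SwapCase i j k i
    untouched : k ≢ i → k ≢ j → SwapCase i j k k

  swapCase : (i j k : Fin n) → SwapCase i j k (swap i j k)
  swapCase i j k = cases (k ≟ i) (k ≟ j)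
    where
    cases : Dec (k ≡ i) → Dec (k ≡ j) → SwapCase i j k (swap i j k)
    cases (yes refl) _      = subst (SwapCase i j k) (sym (swap-at-fst i j)) (at-fst refl)
    cases (no _) (yes refl) = subst (SwapCase i j k) (sym (swap-at-snd i j)) (at-snd refl)
    cases (no k≢i) (no k≢j) = subst (SwapCase i j k) (sym (swap-untouched k≢i k≢j)) (untouched k≢i k≢j)

  swap-comm : (i j k : Fin n) → swap i j k ≡ swap j i k
  swap-comm i j k with swap i j k | swapCase i j k
  ... | _ | at-fst refl       = sym (swap-at-snd j i)
  ... | _ | at-snd refl       = sym (swap-at-fst j i)
  ... | _ | untouched k≢i k≢j = sym (swap-untouched k≢j k≢i)

  adjacent-sym : {i j : Fin n} → Adjacent i j → Adjacent j i
  adjacent-sym (inj₁ e) = inj₂ e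
  adjacent-sym (inj₂ e) = inj₁ e

  adjacent-≢ : {i j : Fin n} → Adjacent i j → i ≢ j
  adjacent-≢ (inj₁ e) refl = ℕ.<-irrefl e (ℕ.n<1+n _)
  adjacent-≢ (inj₂ e) refl = ℕ.<-irrefl e (ℕ.n<1+n _)

  adjacent-above : {i j k : Fin n} → Adjacent i j → i < k → k ≢ j → j < k
  adjacent-above {k = k} (inj₁ e) i<k k≢j = ≤∧≢⇒< (subst (ℕ._≤ toℕ k) (sym e) i<k) (k≢j ∘ sym)
  adjacent-above         (inj₂ e) i<k k≢j = <-trans (ℕ.≤-reflexive (sym e)) i<k

  adjacent-below : {i j k : Fin n} → Adjacent i j → k < i → k ≢ j → k < j
  adjacent-below         (inj₁ e) k<i k≢j = <-trans k<i (ℕ.≤-reflexive (sym e))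
  adjacent-below {k = k} (inj₂ e) k<i k≢j = ≤∧≢⇒< (ℕ.≤-pred (subst (toℕ k ℕ.<_) e k<i)) k≢j

  -- Nothing lies strictly between two adjacent positions, so swapping them moves no other pair past each other.
  swap-adjacent-monotone : {i j p q : Fin n} → Adjacent i j → p < q → ¬ SameEdge (p , q) (i , j) →
                           swap i j p < swap i j q
  swap-adjacent-monotone {i} {j} {p} {q} adj p<q ne
    with swap i j p | swapCase i j p | swap i j q | swapCase i j q
  ... | _ | at-fst refl     | _ | at-fst refl     = contradiction p<q (<-irrefl refl)
  ... | _ | at-fst refl     | _ | at-snd refl     = contradiction (inj₁ (refl , refl)) ne
  ... | _ | at-fst refl     | _ | untouched _ q≢j = adjacent-above adj p<q q≢j
  ... | _ | at-snd refl     | _ | at-fst refl     = contradiction (inj₂ (refl , refl)) ne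
  ... | _ | at-snd refl     | _ | at-snd refl     = contradiction p<q (<-irrefl refl)
  ... | _ | at-snd refl     | _ | untouched q≢i _ = adjacent-above (adjacent-sym adj) p<q q≢i
  ... | _ | untouched _ p≢j | _ | at-fst refl     = adjacent-below adj p<q p≢j
  ... | _ | untouched p≢i _ | _ | at-snd refl     = adjacent-below (adjacent-sym adj) p<q p≢i
  ... | _ | untouched _ _   | _ | untouched _ _   = p<q

  sameEdge-sym : {x y : Pair n} → SameEdge x y → SameEdge y x
  sameEdge-sym (inj₁ (refl , refl)) = inj₁ (refl , refl)
  sameEdge-sym (inj₂ (refl , refl)) = inj₂ (refl , refl)

  sameEdge-trans : {x y z : Pair n} → SameEdge x y → SameEdge y z → SameEdge x z
  sameEdge-trans (inj₁ (refl , refl)) s                    = s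
  sameEdge-trans (inj₂ (refl , refl)) (inj₁ (refl , refl)) = inj₂ (refl , refl)
  sameEdge-trans (inj₂ (refl , refl)) (inj₂ (refl , refl)) = inj₁ (refl , refl)

  sameEdge-flip : (a b : Fin n) → SameEdge (a , b) (b , a)
  sameEdge-flip a b = inj₂ (refl , refl)

  sameEdge? : (x y : Pair n) → Dec (SameEdge x y)
  sameEdge? (u , v) (a , b) = ((u ≟ a) ×-dec (v ≟ b)) ⊎-dec ((u ≟ b) ×-dec (v ≟ a))

  sameEdge-injective : {g : Fin n → Fin n} → (∀ {a b} → g a ≡ g b → a ≡ b) →
                       {x y : Pair n} → SameEdge (mapPair g x) (mapPair g y) → SameEdge x y
  sameEdge-injective inj (inj₁ (e₁ , e₂)) = inj₁ (inj e₁ , inj e₂)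
  sameEdge-injective inj (inj₂ (e₁ , e₂)) = inj₂ (inj e₁ , inj e₂)

  sortEdge : (u v : Fin n) → u ≢ v → ∃[ a ] ∃[ b ] (a < b × SameEdge (a , b) (u , v))
  sortEdge u v u≢v with <-cmp u v
  ... | tri< u<v _ _ = u , v , u<v , inj₁ (refl , refl)
  ... | tri≈ _ u≡v _ = contradiction u≡v u≢v
  ... | tri> _ _ v<u = v , u , v<u , inj₂ (refl , refl)

module _ {n : ℕ} where

  infix 4 _≺[_]_

  -- A record rather than a synonym, so that a, π and b are inferable from a proof.
  record _≺[_]_ (a : Fin n) (π : Ordering n) (b : Fin n) : Set where
    constructor before
    field pos-< : pos π a < pos π b

  _≺[_]?_ : (a : Fin n) (π : Ordering n) (b : Fin n) → Dec (a ≺[ π ] b)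
  a ≺[ π ]? b = map′ before _≺[_]_.pos-< (pos π a <? pos π b)

  pos-injective : (π : Ordering n) {a b : Fin n} → pos π a ≡ pos π b → a ≡ b
  pos-injective π {a} {b} e = trans (sym (inverseʳ π)) (trans (cong (π ⟨$⟩ʳ_) e) (inverseʳ π))

  ≺-irrefl : {π : Ordering n} {a : Fin n} → ¬ a ≺[ π ] a
  ≺-irrefl (before a<a) = <-irrefl refl a<a

  ≺-asym : {π : Ordering n} {a b : Fin n} → a ≺[ π ] b → ¬ b ≺[ π ] a
  ≺-asym (before a<b) (before b<a) = <-asym a<b b<a

  ≺⇒≢ : {π : Ordering n} {a b : Fin n} → a ≺[ π ] b → a ≢ b
  ≺⇒≢ a≺b refl = ≺-irrefl a≺b

  ≺-connex : (π : Ordering n) {a b : Fin n} → a ≢ b → a ≺[ π ] b ⊎ b ≺[ π ] a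
  ≺-connex π {a} {b} a≢b with <-cmp (pos π a) (pos π b)
  ... | tri< a<b _ _ = inj₁ (before a<b)
  ... | tri≈ _ e _   = contradiction (pos-injective π e) a≢b
  ... | tri> _ _ b<a = inj₂ (before b<a)

  pos-cross : (π : Ordering n) (u v a : Fin n) → pos (cross π (u , v)) a ≡ swap (pos π u) (pos π v) (pos π a)
  pos-cross π u v a = swap-comm (pos π v) (pos π u) (pos π a)

  pos-cross-fst : (π : Ordering n) (u v : Fin n) → pos (cross π (u , v)) u ≡ pos π v
  pos-cross-fst π u v = swap-at-snd (pos π v) (pos π u)

  pos-cross-snd : (π : Ordering n) (u v : Fin n) → pos (cross π (u , v)) v ≡ pos π u
  pos-cross-snd π u v = swap-at-fst (pos π v) (pos π u)

  cross-preserves-≺ : {π : Ordering n} {u v a b : Fin n} → Adjacent (pos π u) (pos π v) →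
                      ¬ SameEdge (a , b) (u , v) → a ≺[ π ] b → a ≺[ cross π (u , v) ] b
  cross-preserves-≺ {π} {u} {v} {a} {b} adj ne (before a<b) = before
    (subst₂ _<_ (sym (pos-cross π u v a)) (sym (pos-cross π u v b))
      (swap-adjacent-monotone adj a<b (ne ∘ sameEdge-injective (pos-injective π))))

  cross-reflects-≺ : {π : Ordering n} {u v a b : Fin n} → Adjacent (pos π u) (pos π v) →
                     ¬ SameEdge (a , b) (u , v) → a ≺[ cross π (u , v) ] b → a ≺[ π ] b
  cross-reflects-≺ {π} {u} {v} {a} {b} adj ne a≺′b with ≺-connex π (≺⇒≢ a≺′b)
  ... | inj₁ a≺b = a≺b
  ... | inj₂ b≺a =
    contradiction (cross-preserves-≺ adj (ne ∘ sameEdge-trans (sameEdge-flip a b)) b≺a) (≺-asym a≺′b)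

  cross-flips-≺ : {π : Ordering n} {u v a b : Fin n} → SameEdge (a , b) (u , v) →
                  a ≺[ π ] b → b ≺[ cross π (u , v) ] a
  cross-flips-≺ {π} {u} {v} (inj₁ (refl , refl)) (before a<b) =
    before (subst₂ _<_ (sym (pos-cross-snd π u v)) (sym (pos-cross-fst π u v)) a<b)
  cross-flips-≺ {π} {u} {v} (inj₂ (refl , refl)) (before b<a) =
    before (subst₂ _<_ (sym (pos-cross-fst π u v)) (sym (pos-cross-snd π u v)) b<a)

crossAll : ∀ {n m} → Ordering n → Vec (Pair n) m → Ordering n
crossAll π []       = π
crossAll π (x ∷ xs) = crossAll (cross π x) xs

module _ {n : ℕ} where

  crossAll-preserves-≺ : ∀ {m} {π : Ordering n} {xs : Vec (Pair n) m} {a b : Fin n} → Schedule π xs →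
                         (∀ t → ¬ SameEdge (lookup xs t) (a , b)) → a ≺[ π ] b → a ≺[ crossAll π xs ] b
  crossAll-preserves-≺ []         uncrossed a≺b = a≺b
  crossAll-preserves-≺ (adj ∷ sc) uncrossed a≺b =
    crossAll-preserves-≺ sc (uncrossed ∘ suc) (cross-preserves-≺ adj (uncrossed zero ∘ sameEdge-sym) a≺b)

  crossAll-flips-≺ : ∀ {m} {π : Ordering n} {xs : Vec (Pair n) m} {a b : Fin n} → Schedule π xs →
                     (t : Fin m) → SameEdge (lookup xs t) (a , b) →
                     (∀ s → SameEdge (lookup xs s) (a , b) → s ≡ t) →
                     a ≺[ π ] b → b ≺[ crossAll π xs ] a
  crossAll-flips-≺ {a = a} {b} (adj ∷ sc) zero crossed once a≺b =
    crossAll-preserves-≺ sc (λ s e → 0≢1+n (sym (once (suc s) (sameEdge-trans e (sameEdge-flip b a)))))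
      (cross-flips-≺ (sameEdge-sym crossed) a≺b)
  crossAll-flips-≺ (adj ∷ sc) (suc t) crossed once a≺b =
    crossAll-flips-≺ sc t crossed (λ s e → suc-injective (once (suc s) e))
      (cross-preserves-≺ adj (λ e → 0≢1+n (once zero (sameEdge-sym e))) a≺b)

  crossed-if-flipped : ∀ {m} {π : Ordering n} {xs : Vec (Pair n) m} {a b : Fin n} → Schedule π xs →
                       a ≺[ π ] b → b ≺[ crossAll π xs ] a → ∃[ t ] SameEdge (lookup xs t) (a , b)
  crossed-if-flipped [] a≺b b≺a = contradiction b≺a (≺-asym a≺b)
  crossed-if-flipped {xs = x ∷ _} {a} {b} (adj ∷ sc) a≺b b≺′a with sameEdge? x (a , b)
  ... | yes crossed = zero , crossed
  ... | no ne with crossed-if-flipped sc (cross-preserves-≺ adj (ne ∘ sameEdge-sym) a≺b) b≺′a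
  ...   | t , crossed = suc t , crossed

  schedule-loopless : ∀ {m} {π : Ordering n} {xs : Vec (Pair n) m} → Schedule π xs →
                      ∀ t → proj₁ (lookup xs t) ≢ proj₂ (lookup xs t)
  schedule-loopless {π = π} (adj ∷ sc) zero    = adjacent-≢ adj ∘ cong (pos π)
  schedule-loopless         (adj ∷ sc) (suc t) = schedule-loopless sc t

module _ {n : ℕ} where

  data NormT (i j : Fin n) : Pair n → Set where
    ordered  : i < j → NormT i j (i , j)
    reversed : ¬ i < j → NormT i j (j , i)

  normT-view : (i j : Fin n) → NormT i j (normT i j)
  normT-view i j = view (i <? j)
    where
    view : (d : Dec (i < j)) → NormT i j (if does d then (i , j) else (j , i))
    view (yes i<j) = ordered i<j
    view (no i≮j)  = reversed i≮j

  normT-< : {i j : Fin n} → i < j → normT i j ≡ (i , j)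
  normT-< {i} {j} i<j with normT i j | normT-view i j
  ... | _ | ordered _     = refl
  ... | _ | reversed i≮j = contradiction i<j i≮j

  normT-sameEdge : (i j : Fin n) → SameEdge (normT i j) (i , j)
  normT-sameEdge i j with normT i j | normT-view i j
  ... | _ | ordered _  = inj₁ (refl , refl)
  ... | _ | reversed _ = inj₂ (refl , refl)

  normT-comm : (i j : Fin n) → normT i j ≡ normT j i
  normT-comm i j with normT i j | normT-view i j | normT j i | normT-view j i
  ... | _ | ordered i<j  | _ | ordered j<i  = contradiction j<i (<-asym i<j)
  ... | _ | ordered _    | _ | reversed _   = refl
  ... | _ | reversed _   | _ | ordered _    = refl
  ... | _ | reversed i≮j | _ | reversed j≮i with <-cmp i j
  ...   | tri< i<j _ _ = contradiction i<j i≮j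
  ...   | tri≈ _ refl _ = refl
  ...   | tri> _ _ j<i = contradiction j<i j≮i

  normT-respects-sameEdge : {i j i′ j′ : Fin n} → SameEdge (i , j) (i′ , j′) → normT i j ≡ normT i′ j′
  normT-respects-sameEdge (inj₁ (refl , refl)) = refl
  normT-respects-sameEdge {i} {j} (inj₂ (refl , refl)) = normT-comm i j

  normT-injective : {i j i′ j′ : Fin n} → normT i j ≡ normT i′ j′ → SameEdge (i , j) (i′ , j′)
  normT-injective {i} {j} {i′} {j′} e =
    sameEdge-trans (sameEdge-sym (normT-sameEdge i j))
                   (subst (λ x → SameEdge x (i′ , j′)) (sym e) (normT-sameEdge i′ j′))

  swap-respects-sameEdge : {i j i′ j′ : Fin n} → SameEdge (i , j) (i′ , j′) →
                           ∀ k → swap i j k ≡ swap i′ j′ k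
  swap-respects-sameEdge (inj₁ (refl , refl)) k = refl
  swap-respects-sameEdge {i} {j} (inj₂ (refl , refl)) k = swap-comm i j k

  normT-adjacent : {i j : Fin n} → Adjacent i j → toℕ (proj₂ (normT i j)) ≡ suc (toℕ (proj₁ (normT i j)))
  normT-adjacent {i} {j} adj with normT i j | normT-view i j | adj
  ... | _ | ordered _    | inj₁ e = e
  ... | _ | ordered i<j  | inj₂ e = contradiction (ℕ.≤-reflexive (sym e)) (<-asym i<j)
  ... | _ | reversed _   | inj₂ e = e
  ... | _ | reversed i≮j | inj₁ e = contradiction (ℕ.≤-reflexive (sym e)) i≮j

SimpleTranspositions : ∀ {n m} → Vec (Pair n) m → Set
SimpleTranspositions ts = ∀ t → toℕ (proj₂ (lookup ts t)) ≡ suc (toℕ (proj₁ (lookup ts t)))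

module _ {n : ℕ} where

  taus-simple : ∀ {m} {π : Ordering n} {xs : Vec (Pair n) m} → Schedule π xs → SimpleTranspositions (taus π xs)
  taus-simple (adj ∷ sc) zero    = normT-adjacent adj
  taus-simple (adj ∷ sc) (suc t) = taus-simple sc t

  prodT-taus : ∀ {m} (π : Ordering n) (xs : Vec (Pair n) m) (k : Fin n) →
               π ⟨$⟩ʳ prodT (taus π xs) k ≡ crossAll π xs ⟨$⟩ʳ k
  prodT-taus π []             k = refl
  prodT-taus π ((u , v) ∷ xs) k =
    trans (cong (π ⟨$⟩ʳ_) (swap-respects-sameEdge (normT-sameEdge (pos π u) (pos π v))
                                                        (prodT (taus (cross π (u , v)) xs) k)))
          (prodT-taus (cross π (u , v)) xs k)

module _ {n : ℕ} where

  Reverses : Ordering n → Ordering n → Set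
  Reverses π ρ = ∀ {a b} → a ≺[ π ] b → b ≺[ ρ ] a

  reverses⇒opposite : {π ρ : Ordering n} → Reverses π ρ → ∀ k → pos π (ρ ⟨$⟩ʳ k) ≡ opposite k
  reverses⇒opposite {π} {ρ} reverses = strictlyDecreasing⇒≗opposite (λ k → pos π (ρ ⟨$⟩ʳ k)) decreasing
    where
    ρ-order : ∀ {p q} → p < q → (ρ ⟨$⟩ʳ p) ≺[ ρ ] (ρ ⟨$⟩ʳ q)
    ρ-order p<q = before (subst₂ _<_ (sym (inverseˡ ρ)) (sym (inverseˡ ρ)) p<q)

    decreasing : ∀ {p q} → p < q → pos π (ρ ⟨$⟩ʳ q) < pos π (ρ ⟨$⟩ʳ p)
    decreasing p<q with ≺-connex π (≺⇒≢ (ρ-order p<q))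
    ... | inj₁ π-order       = contradiction (reverses π-order) (≺-asym (ρ-order p<q))
    ... | inj₂ (before q<p) = q<p

  opposite⇒reverses : {π ρ : Ordering n} → (∀ k → pos π (ρ ⟨$⟩ʳ k) ≡ opposite k) → Reverses π ρ
  opposite⇒reverses {π} {ρ} ρ≗π∘opposite {a} {b} (before a<b) =
    before (subst₂ _<_ (sym (pos-ρ b)) (sym (pos-ρ a)) (opposite-reverses-< a<b))
    where
    pos-ρ : ∀ c → pos ρ c ≡ opposite (pos π c)
    pos-ρ c = trans (sym (opposite-involutive (pos ρ c)))
                    (cong opposite (trans (sym (ρ≗π∘opposite (pos ρ c))) (cong (pos π) (inverseʳ ρ))))

  clique-schedule-reverses : (G : TClique n) {π : Ordering n} → Schedule π (edges G) →
                             Reverses π (crossAll π (edges G))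
  clique-schedule-reverses G sc {a} {b} a≺b with complete G a b (≺⇒≢ a≺b)
  ... | t , crossed =
    crossAll-flips-≺ sc t crossed (λ s e → simple G s t (sameEdge-trans e (sameEdge-sym crossed))) a≺b

  f-reducedDecomp : (G : TClique n) (π : Ordering n) → Schedule π (edges G) → ReducedDecomp n (f G π)
  f-reducedDecomp G π sc = taus-simple sc , λ k → begin
    prodT (f G π) k                       ≡⟨ sym (inverseˡ π) ⟩
    pos π (π ⟨$⟩ʳ prodT (f G π) k)        ≡⟨ cong (pos π) (prodT-taus π (edges G) k) ⟩
    pos π (crossAll π (edges G) ⟨$⟩ʳ k)   ≡⟨ reverses⇒opposite (clique-schedule-reverses G sc) k ⟩
    opposite k                            ∎
    where open ≡-Reasoning

module _ {n : ℕ} where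

  record Carries (σ : Fin n → Fin n) (π π′ : Ordering n) : Set where
    constructor carrying
    field carries : ∀ k → σ (π ⟨$⟩ʳ k) ≡ π′ ⟨$⟩ʳ k

  module _ {σ : Fin n → Fin n} {π π′ : Ordering n} (C : Carries σ π π′) where
    open Carries C

    pos-carried : ∀ u → pos π′ (σ u) ≡ pos π u
    pos-carried u =
      trans (cong (pos π′ ∘ σ) (sym (inverseʳ π))) (trans (cong (pos π′) (carries (pos π u))) (inverseˡ π′))

    carried-by-pos : ∀ {u u′} → pos π u ≡ pos π′ u′ → σ u ≡ u′
    carried-by-pos {u} {u′} e =
      trans (cong σ (sym (inverseʳ π)))
            (trans (carries (pos π u)) (trans (cong (π′ ⟨$⟩ʳ_) e) (inverseʳ π′)))

    sameEdge-pos : ∀ {u v u′ v′} → SameEdge (σ u , σ v) (u′ , v′) →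
                   SameEdge (pos π u , pos π v) (pos π′ u′ , pos π′ v′)
    sameEdge-pos {u} {v} (inj₁ (refl , refl)) = inj₁ (sym (pos-carried u) , sym (pos-carried v))
    sameEdge-pos {u} {v} (inj₂ (refl , refl)) = inj₂ (sym (pos-carried u) , sym (pos-carried v))

    sameEdge-carried : ∀ {u v u′ v′} → SameEdge (pos π u , pos π v) (pos π′ u′ , pos π′ v′) →
                       SameEdge (σ u , σ v) (u′ , v′)
    sameEdge-carried (inj₁ (e₁ , e₂)) = inj₁ (carried-by-pos e₁ , carried-by-pos e₂)
    sameEdge-carried (inj₂ (e₁ , e₂)) = inj₂ (carried-by-pos e₁ , carried-by-pos e₂)

    cross-carried : ∀ {u v u′ v′} → SameEdge (σ u , σ v) (u′ , v′) →
                    Carries σ (cross π (u , v)) (cross π′ (u′ , v′))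
    cross-carried {u} {v} se = carrying λ k →
      trans (carries _) (cong (π′ ⟨$⟩ʳ_) (swap-respects-sameEdge (sameEdge-pos se) k))

  taus-carried : ∀ {m} {σ : Fin n → Fin n} {π π′ : Ordering n} (xs ys : Vec (Pair n) m) →
                 Carries σ π π′ →
                 (∀ t → SameEdge (mapPair σ (lookup xs t)) (lookup ys t)) → taus π xs ≡ taus π′ ys
  taus-carried []       []       C same = refl
  taus-carried (x ∷ xs) (y ∷ ys) C same =
    cong₂ _∷_ (normT-respects-sameEdge (sameEdge-pos C (same zero)))
              (taus-carried xs ys (cross-carried C (same zero)) (same ∘ suc))

  carried-taus : ∀ {m} {σ : Fin n → Fin n} {π π′ : Ordering n} (xs ys : Vec (Pair n) m) →
                 Carries σ π π′ →
                 taus π xs ≡ taus π′ ys → ∀ t → SameEdge (mapPair σ (lookup xs t)) (lookup ys t)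
  carried-taus (x ∷ xs) (y ∷ ys) C e zero    = sameEdge-carried C (normT-injective (∷-injectiveˡ e))
  carried-taus (x ∷ xs) (y ∷ ys) C e (suc t) =
    carried-taus xs ys (cross-carried C (carried-taus (x ∷ xs) (y ∷ ys) C e zero)) (∷-injectiveʳ e) t

  f-respects-iso : (G G′ : TClique n) (π π′ : Ordering n) → PairIso G π G′ π′ → f G π ≡ f G′ π′
  f-respects-iso G G′ π π′ (σ , same , carries) =
    taus-carried (edges G) (edges G′) (carrying {σ = σ ⟨$⟩ʳ_} carries) same

  f-injective-up-to-iso : (G G′ : TClique n) (π π′ : Ordering n) → f G π ≡ f G′ π′ → PairIso G π G′ π′
  f-injective-up-to-iso G G′ π π′ e =
    σ , carried-taus (edges G) (edges G′) (carrying {σ = σ ⟨$⟩ʳ_} carries) e , carries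
    where
    σ = flip π ∘ₚ π′
    carries : ∀ k → σ ⟨$⟩ʳ (π ⟨$⟩ʳ k) ≡ π′ ⟨$⟩ʳ k
    carries k = cong (π′ ⟨$⟩ʳ_) (inverseˡ π)

module _ {n : ℕ} where

  Inverted : Ordering n → Fin n → Fin n → Set
  Inverted π a b = a < b × b ≺[ π ] a

  inverted? : (π : Ordering n) (a b : Fin n) → Dec (Inverted π a b)
  inverted? π a b = (a <? b) ×-dec (b ≺[ π ]? a)

  inversions : Ordering n → ℕ
  inversions π = sum λ (b : Fin n) → sum λ (a : Fin n) → indicator (inverted? π a b)

  inversions-id : inversions idₚ ≡ 0
  inversions-id =
    sum-zero λ b → sum-zero λ a → indicator-no (inverted? idₚ a b) λ (a<b , before b<a) → <-asym a<b b<a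

  inversions-reversal : {ρ : Ordering n} → Reverses idₚ ρ → inversions ρ ≡ numLabels n
  inversions-reversal {ρ} reverses =
    trans (sum-cong-≗ λ b → trans (sum-cong-≗ λ a → indicator-cong (inverted? ρ a b) (a <? b) inverted⇔<)
                                  (sum-indicator-< b))
          (sum-toℕ n)
    where
    inverted⇔< : ∀ {a b} → Inverted ρ a b ⇔ a < b
    inverted⇔< = mk⇔ proj₁ λ a<b → a<b , reverses (before a<b)

  inversions-bump : {π π′ : Ordering n} (a₀ b₀ : Fin n) →
                    (∀ a b → ¬ (a ≡ a₀ × b ≡ b₀) → Inverted π a b ⇔ Inverted π′ a b) →
                    ¬ Inverted π a₀ b₀ → Inverted π′ a₀ b₀ → inversions π′ ≡ suc (inversions π)
  inversions-bump {π} {π′} a₀ b₀ elsewhere ¬inv inv =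
    sum-bump b₀ (λ b b≢b₀ → sum-cong-≗ λ a → same a b (elsewhere a b (b≢b₀ ∘ proj₂)))
      (sum-bump a₀ (λ a a≢a₀ → same a b₀ (elsewhere a b₀ (a≢a₀ ∘ proj₁)))
        (trans (indicator-yes (inverted? π′ a₀ b₀) inv) (cong suc (sym (indicator-no (inverted? π a₀ b₀) ¬inv)))))
    where
    same : ∀ a b → Inverted π a b ⇔ Inverted π′ a b → indicator (inverted? π a b) ≡ indicator (inverted? π′ a b)
    same a b = indicator-cong (inverted? π a b) (inverted? π′ a b)

  InvertedPair : Ordering n → Pair n → Set
  InvertedPair π (u , v) = Inverted π u v ⊎ Inverted π v u

  invertedPair? : (π : Ordering n) (x : Pair n) → Dec (InvertedPair π x)
  invertedPair? π (u , v) = inverted? π u v ⊎-dec inverted? π v u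

  invertedPair-sorted : {π : Ordering n} {a b : Fin n} {x : Pair n} → a < b → SameEdge (a , b) x →
                        InvertedPair π x ⇔ Inverted π a b
  invertedPair-sorted a<b (inj₁ (refl , refl)) =
    mk⇔ (λ { (inj₁ inv) → inv ; (inj₂ (b<a , _)) → contradiction b<a (<-asym a<b) }) inj₁
  invertedPair-sorted a<b (inj₂ (refl , refl)) =
    mk⇔ (λ { (inj₂ inv) → inv ; (inj₁ (b<a , _)) → contradiction b<a (<-asym a<b) }) inj₂

  not-inverted⇒≺ : {π : Ordering n} {a b : Fin n} → a < b → ¬ Inverted π a b → a ≺[ π ] b
  not-inverted⇒≺ {π} a<b ¬inv with ≺-connex π (<⇒≢ a<b)
  ... | inj₁ a≺b = a≺b
  ... | inj₂ b≺a = contradiction (a<b , b≺a) ¬inv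

  module _ {π : Ordering n} {u v : Fin n} (adj : Adjacent (pos π u) (pos π v)) where

    cross-preserves-invertedPair : {y : Pair n} → ¬ SameEdge y (u , v) →
                                   InvertedPair π y → InvertedPair (cross π (u , v)) y
    cross-preserves-invertedPair {a , b} ne (inj₁ (a<b , b≺a)) =
      inj₁ (a<b , cross-preserves-≺ adj (ne ∘ sameEdge-trans (sameEdge-flip a b)) b≺a)
    cross-preserves-invertedPair {a , b} ne (inj₂ (b<a , a≺b)) =
      inj₂ (b<a , cross-preserves-≺ adj ne a≺b)

    module _ {a₀ b₀ : Fin n} (a₀<b₀ : a₀ < b₀) (sorted : SameEdge (a₀ , b₀) (u , v)) where

      inverted-cross-elsewhere : ∀ a b → ¬ (a ≡ a₀ × b ≡ b₀) →
                                 Inverted π a b ⇔ Inverted (cross π (u , v)) a b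
      inverted-cross-elsewhere a b ne =
        mk⇔ (λ (a<b , b≺a) → a<b , cross-preserves-≺ adj (uncrossed a<b) b≺a)
            (λ (a<b , b≺a) → a<b , cross-reflects-≺ adj (uncrossed a<b) b≺a)
        where
        uncrossed : a < b → ¬ SameEdge (b , a) (u , v)
        uncrossed a<b s with sameEdge-trans s (sameEdge-sym sorted)
        ... | inj₁ (b≡a₀ , a≡b₀) = <-asym a₀<b₀ (subst₂ _<_ a≡b₀ b≡a₀ a<b)
        ... | inj₂ (b≡b₀ , a≡a₀) = ne (a≡a₀ , b≡b₀)

      inversions-cross-sorted-rising : ¬ Inverted π a₀ b₀ → inversions (cross π (u , v)) ≡ suc (inversions π)
      inversions-cross-sorted-rising ¬inv =
        inversions-bump a₀ b₀ inverted-cross-elsewhere ¬inv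
          (a₀<b₀ , cross-flips-≺ sorted (not-inverted⇒≺ a₀<b₀ ¬inv))

      inversions-cross-sorted-falling : Inverted π a₀ b₀ → inversions π ≡ suc (inversions (cross π (u , v)))
      inversions-cross-sorted-falling (_ , b₀≺a₀) =
        inversions-bump a₀ b₀ (λ a b ne → ⇔-sym (inverted-cross-elsewhere a b ne))
          (λ (_ , b₀≺′a₀) →
            ≺-asym b₀≺′a₀ (cross-flips-≺ (sameEdge-trans (sameEdge-flip b₀ a₀) sorted) b₀≺a₀))
          (a₀<b₀ , b₀≺a₀)

    crossing-sorted : ∃[ a₀ ] ∃[ b₀ ] (a₀ < b₀ × SameEdge (a₀ , b₀) (u , v))
    crossing-sorted = sortEdge u v (adjacent-≢ adj ∘ cong (pos π))

    inversions-cross-rising : ¬ InvertedPair π (u , v) → inversions (cross π (u , v)) ≡ suc (inversions π)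
    inversions-cross-rising rising with crossing-sorted
    ... | _ , _ , a₀<b₀ , sorted =
      inversions-cross-sorted-rising a₀<b₀ sorted (rising ∘ Equivalence.from (invertedPair-sorted a₀<b₀ sorted))

    inversions-cross-falling : InvertedPair π (u , v) → inversions π ≡ suc (inversions (cross π (u , v)))
    inversions-cross-falling falling with crossing-sorted
    ... | _ , _ , a₀<b₀ , sorted =
      inversions-cross-sorted-falling a₀<b₀ sorted (Equivalence.to (invertedPair-sorted a₀<b₀ sorted) falling)

    cross-inverts : ¬ InvertedPair π (u , v) → InvertedPair (cross π (u , v)) (u , v)
    cross-inverts rising with crossing-sorted
    ... | _ , _ , a₀<b₀ , sorted =
      Equivalence.from (invertedPair-sorted a₀<b₀ sorted) (a₀<b₀ , cross-flips-≺ sorted (not-inverted⇒≺ a₀<b₀ ¬inv))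
      where ¬inv = rising ∘ Equivalence.from (invertedPair-sorted a₀<b₀ sorted)

  invertedPair-respects-sameEdge : {π : Ordering n} {x y : Pair n} → SameEdge x y →
                                   InvertedPair π x → InvertedPair π y
  invertedPair-respects-sameEdge (inj₁ (refl , refl)) = λ inv → inv
  invertedPair-respects-sameEdge (inj₂ (refl , refl)) = ⊎-swap

Rising : ∀ {n m} → Ordering n → Vec (Pair n) m → Set
Rising π []       = ⊤
Rising π (x ∷ xs) = ¬ InvertedPair π x × Rising (cross π x) xs

module _ {n : ℕ} where

  inversions-crossAll-≤ : ∀ {m} {π : Ordering n} {xs : Vec (Pair n) m} → Schedule π xs →
                          inversions (crossAll π xs) ℕ.≤ inversions π + m
  inversions-crossAll-≤ {π = π} [] = ℕ.m≤m+n (inversions π) 0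
  inversions-crossAll-≤ {suc m} {π} {x ∷ xs} (adj ∷ sc) with invertedPair? π x
  ... | no rising = begin
    inversions (crossAll (cross π x) xs)  ≤⟨ inversions-crossAll-≤ sc ⟩
    inversions (cross π x) + m            ≡⟨ cong (_+ m) (inversions-cross-rising adj rising) ⟩
    suc (inversions π) + m                ≡⟨ ℕ.+-suc (inversions π) m ⟨
    inversions π + suc m                  ∎
    where open ℕ.≤-Reasoning
  ... | yes falling = begin
    inversions (crossAll (cross π x) xs)  ≤⟨ inversions-crossAll-≤ sc ⟩
    inversions (cross π x) + m            ≤⟨ ℕ.+-mono-≤ (ℕ.n≤1+n _) (ℕ.n≤1+n m) ⟩
    suc (inversions (cross π x)) + suc m  ≡⟨ cong (_+ suc m) (inversions-cross-falling adj falling) ⟨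
    inversions π + suc m                  ∎
    where open ℕ.≤-Reasoning

  -- A falling step costs two inversions below the bound, so a schedule attaining it has none.
  rising-if-maximal : ∀ {m} {π : Ordering n} {xs : Vec (Pair n) m} → Schedule π xs →
                      inversions (crossAll π xs) ≡ inversions π + m → Rising π xs
  rising-if-maximal [] _ = tt
  rising-if-maximal {suc m} {π} {x ∷ xs} (adj ∷ sc) maximal with invertedPair? π x
  ... | no rising = rising , rising-if-maximal sc
          (trans maximal (trans (ℕ.+-suc (inversions π) m) (cong (_+ m) (sym (inversions-cross-rising adj rising)))))
  ... | yes falling = contradiction (inversions-crossAll-≤ sc) (ℕ.<⇒≱ (begin-strict
    inversions (cross π x) + m            <⟨ ℕ.+-mono-< (ℕ.n<1+n _) (ℕ.n<1+n m) ⟩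
    suc (inversions (cross π x)) + suc m  ≡⟨ cong (_+ suc m) (inversions-cross-falling adj falling) ⟨
    inversions π + suc m                  ≡⟨ maximal ⟨
    inversions (crossAll (cross π x) xs)  ∎))
    where open ℕ.≤-Reasoning

  rising-never-recrosses : ∀ {m} {π : Ordering n} {xs : Vec (Pair n) m} {y : Pair n} →
                           Schedule π xs → Rising π xs → InvertedPair π y → ∀ t → ¬ SameEdge (lookup xs t) y
  rising-never-recrosses (adj ∷ sc) (rising , _) inv zero s =
    rising (invertedPair-respects-sameEdge (sameEdge-sym s) inv)
  rising-never-recrosses (adj ∷ sc) (rising , rest) inv (suc t) =
    rising-never-recrosses sc rest
      (cross-preserves-invertedPair adj (rising ∘ λ s → invertedPair-respects-sameEdge s inv) inv) t

  rising-simple : ∀ {m} {π : Ordering n} {xs : Vec (Pair n) m} → Schedule π xs → Rising π xs →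
                  ∀ t s → SameEdge (lookup xs t) (lookup xs s) → t ≡ s
  rising-simple (adj ∷ sc) (rising , rest) zero    zero    _  = refl
  rising-simple (adj ∷ sc) (rising , rest) zero    (suc s) se =
    contradiction (sameEdge-sym se) (rising-never-recrosses sc rest (cross-inverts adj rising) s)
  rising-simple (adj ∷ sc) (rising , rest) (suc t) zero    se =
    contradiction se (rising-never-recrosses sc rest (cross-inverts adj rising) t)
  rising-simple (adj ∷ sc) (rising , rest) (suc t) (suc s) se = cong suc (rising-simple sc rest t s se)

trace : ∀ {n m} → Ordering n → Vec (Pair n) m → Vec (Pair n) m
trace π []             = []
trace π ((i , j) ∷ ts) = x ∷ trace (cross π x) ts
  where x = π ⟨$⟩ʳ i , π ⟨$⟩ʳ j

module _ {n : ℕ} where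

  trace-schedule : ∀ {m} (π : Ordering n) (ts : Vec (Pair n) m) → SimpleTranspositions ts →
                   Schedule π (trace π ts)
  trace-schedule π []       simple-ts = []
  trace-schedule π (_ ∷ ts) simple-ts =
    subst₂ Adjacent (sym (inverseˡ π)) (sym (inverseˡ π)) (inj₁ (simple-ts zero))
      ∷ trace-schedule _ ts (simple-ts ∘ suc)

  taus-trace : ∀ {m} (π : Ordering n) (ts : Vec (Pair n) m) → SimpleTranspositions ts →
               taus π (trace π ts) ≡ ts
  taus-trace π []       simple-ts = refl
  taus-trace π (_ ∷ ts) simple-ts =
    cong₂ _∷_ (trans (cong₂ normT (inverseˡ π) (inverseˡ π)) (normT-< (ℕ.≤-reflexive (sym (simple-ts zero)))))
              (taus-trace _ ts (simple-ts ∘ suc))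

  f-surjective : ∀ w → ReducedDecomp n w → ∃[ G ] ∃[ π ] (InC' G π × f G π ≡ w)
  f-surjective w (simple-w , w≗opposite) = G , idₚ , (mobile , schedule) , taus-trace idₚ w simple-w
    where
    E = trace idₚ w

    schedule : Schedule idₚ E
    schedule = trace-schedule idₚ w simple-w

    reverses : Reverses idₚ (crossAll idₚ E)
    reverses = opposite⇒reverses λ k → begin
      crossAll idₚ E ⟨$⟩ʳ k   ≡⟨ prodT-taus idₚ E k ⟨
      prodT (taus idₚ E) k    ≡⟨ cong (λ ts → prodT ts k) (taus-trace idₚ w simple-w) ⟩
      prodT w k               ≡⟨ w≗opposite k ⟩
      opposite k              ∎
      where open ≡-Reasoning

    rising : Rising idₚ E
    rising = rising-if-maximal schedule
      (trans (inversions-reversal reverses) (cong (_+ numLabels n) (sym (inversions-id {n}))))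

    complete-E : ∀ u v → u ≢ v → ∃[ t ] SameEdge (lookup E t) (u , v)
    complete-E u v u≢v with sortEdge u v u≢v
    ... | a , b , a<b , sorted with crossed-if-flipped schedule (before a<b) (reverses (before a<b))
    ...   | t , crossed = t , sameEdge-trans crossed sorted

    G : TClique n
    G = record { edges    = E
               ; loopless = schedule-loopless schedule
               ; complete = complete-E
               ; simple   = rising-simple schedule rising
               }

    mobile : Is1DMobility G
    mobile = idₚ , idₚ , subst (Schedule idₚ) (sym (map-id E)) schedule

mainTheorem7 : (n : ℕ) →
    (∀ (G : TClique n) (π : Ordering n) → InC' G π → ReducedDecomp n (f G π))
    × (∀ (G G' : TClique n) (π π' : Ordering n) → InC' G π → InC' G' π' →
         PairIso G π G' π' → f G π ≡ f G' π')
    × (∀ (G G' : TClique n) (π π' : Ordering n) → InC' G π → InC' G' π' →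
         f G π ≡ f G' π' → PairIso G π G' π')
    × (∀ w → ReducedDecomp n w → ∃[ G ] ∃[ π ] (InC' G π × f G π ≡ w))
mainTheorem7 n =
  (λ G π (_ , schedule) → f-reducedDecomp G π schedule) ,
  (λ G G′ π π′ _ _ → f-respects-iso G G′ π π′) ,
  (λ G G′ π π′ _ _ → f-injective-up-to-iso G G′ π π′) ,
  f-surjective
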